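{- Let $v=d^{ -1}(a_1,\ldots,a_n)\in\mathbb{Q}^n$ have denominator $d$, let $U\subseteq\mathbb{R}^n$ be a nonempty open set, and let $T_v:U\to\mathbb{R}^n$ be the translation $u\mapsto u+v$. Then: (i) $T_v$ preserves every denominator $k$ such that $d\,\mathrm{rad}(d)$ divides $k$, i.e., for every such $k$, $T_v$ induces a bijection between $\{u\in U\cap\mathbb{Q}^n:\mathrm{den}(u)=k\}$ and $\{w\in T_v[U]\cap\mathbb{Q}^n:\mathrm{den}(w)=k\}$; (ii) $T_v$ preserves all denominators if and only if $v\in\mathbb{Z}^n$.
   Context: Every $u\in\mathbb{Q}^n$ can be written uniquely as $u=(a_1/k,\ldots,a_n/k)$ with $a_1,\ldots,a_n,k$ integers, $k\ge1$, and $\gcd(a_1,\ldots,a_n,k)=1$; then $k=\mathrm{den}(u)$ is the denominator of $u$. $\mathrm{rad}(d)$ is the product of the distinct prime factors of $d$. A map $F:U\to\mathbb{R}^n$ preserves all denominators if for every integer $k\ge1$ it induces a bijection between $\{u\in U\cap\mathbb{Q}^n:\mathrm{den}(u)=k\}$ and $\{w\in F[U]\cap\mathbb{Q}^n:\mathrm{den}(w)=k\}$.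
   Formalization: The set U is a nonempty open subset of ℚ^n rather than of ℝ^n, open for sup-norm balls of positive rational radius, and $T_v[U]$ is its image in ℚ^n under the translation. -}

module Defs where

open import Data.Nat as ℕ using (ℕ; zero; suc)
open import Data.Nat.Divisibility using (_∣_; _∣?_)
open import Data.Nat.Primality using (Prime; prime?)
open import Data.Integer as ℤ using (ℤ)
open import Data.Rational as ℚ using (ℚ; _/_; 0ℚ)
open import Data.Fin using (Fin)
open import Data.Vec using (Vec; lookup; zipWith)
open import Data.Product using (Σ; ∃; _×_; _,_)
open import Data.Empty using (⊥)
open import Relation.Nullary using (yes; no)
open import Relation.Nullary.Decidable using (_×-dec_)
open import Relation.Binary.PropositionalEquality using (_≡_)

ℚ^ : ℕ → Set
ℚ^ n = Vec ℚ n

HasDen : ∀ {n} → ℚ^ n → ℕ → Set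
HasDen u zero = ⊥
HasDen {n} u (suc m) =
  Σ (Fin n → ℤ) λ a →
    (∀ i → lookup u i ≡ a i / suc m) ×
    (∀ (c : ℕ) → c ∣ suc m → (∀ i → c ∣ ℤ.∣ a i ∣) → c ≡ 1)

radUpTo : ℕ → ℕ → ℕ
radUpTo d zero = 1
radUpTo d (suc p) with prime? (suc p) ×-dec (suc p ∣? d)
... | yes _ = suc p ℕ.* radUpTo d p
... | no  _ = radUpTo d p

rad : ℕ → ℕ
rad d = radUpTo d d

translate : ∀ {n} → ℚ^ n → ℚ^ n → ℚ^ n
translate v u = zipWith ℚ._+_ u v

Image : ∀ {n} → (ℚ^ n → ℚ^ n) → (ℚ^ n → Set) → ℚ^ n → Set
Image F U w = ∃ λ u → U u × F u ≡ w

IsOpen : ∀ {n} → (ℚ^ n → Set) → Set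
IsOpen {n} U = ∀ u → U u → Σ ℚ λ ε → (0ℚ ℚ.< ε) ×
  (∀ w → (∀ i → ℚ.∣ lookup w i ℚ.- lookup u i ∣ ℚ.< ε) → U w)

PreservesDen : ∀ {n} → (ℚ^ n → Set) → (ℚ^ n → ℚ^ n) → ℕ → Set
PreservesDen U F k =
  (∀ u → U u → HasDen u k → HasDen (F u) k) ×
  (∀ u u′ → U u → HasDen u k → U u′ → HasDen u′ k → F u ≡ F u′ → u ≡ u′) ×
  (∀ w → Image F U w → HasDen w k → ∃ λ u → U u × HasDen u k × F u ≡ w)

PreservesAllDen : ∀ {n} → (ℚ^ n → Set) → (ℚ^ n → ℚ^ n) → Set
PreservesAllDen U F = ∀ k → 1 ℕ.≤ k → PreservesDen U F k

IsIntegral : ∀ {n} → ℚ^ n → Set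
IsIntegral {n} v = ∀ (i : Fin n) → ∃ λ (z : ℤ) → lookup v i ≡ z / 1

-- Write Sₖ = (1/k)ℤⁿ. A point has denominator k iff it lies in Sₖ but in no S_{k/p} for a prime
-- p ∣ k. If v ∈ S_d and d·rad(d) ∣ k, then d ∣ k/p for every prime p ∣ k (when p ∣ d because
-- p·d ∣ d·rad(d), otherwise by coprimality), so v ∈ S_{k/p}: translating by ±v maps Sₖ to itself
-- and never moves a point of Sₖ into an S_{k/p}. Conversely, a nonempty open set contains points of
-- S_M for all large M, in particular for some M ≡ 1 (mod d). Such a point has a denominator j ∣ M,
-- coprime to d; if the translation preserves j then v ∈ S_j ∩ S_d, which forces d = 1.

module Submission where

open import Defs
open import Data.Nat using (ℕ; _*_)
open import Data.Nat.Divisibility using (_∣_)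
open import Data.Product using (∃; _×_)
open import Function.Bundles using (_⇔_)

open import Data.Nat.Base using (zero; suc; 2+; _≤_; _<_; z≤n; s≤s; NonZero; NonTrivial)
import Data.Nat.Base as ℕ
import Data.Nat.Properties as ℕP
open import Data.Nat.Properties using (anyUpTo?)
open import Data.Nat.Divisibility
  using (divides; _∣?_; ∣-refl; ∣-trans; _∣0; 1∣_; ∣1⇒≡1; 0∣⇒≡0; ∣⇒≤; m∣m*n; ∣m⇒∣m*n; ∣n⇒∣m*n; ∣m+n∣m⇒∣n; *-monoʳ-∣; *-cancelˡ-∣)
open import Data.Nat.Coprimality as Coprime using (Coprime; coprime-divisor)
open import Data.Nat.Primality using (Prime; prime?; ¬prime[0]; ¬prime[1]; prime⇒irreducible; prime⇒nonZero; prime⇒nonTrivial)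
open import Data.Nat.Primality.Factorisation using (factorise)
open import Data.Nat.Induction using (<-wellFounded)
open import Induction.WellFounded using (Acc; acc)
open import Data.Integer as ℤ using (ℤ; +_)
import Data.Integer.Properties as ℤP
import Data.Integer.DivMod as ℤ
import Data.Integer.Divisibility.Signed as ℤ∣
open import Data.Integer.Tactic.RingSolver using (solve-∀)
open import Data.Rational as ℚ using (ℚ; mkℚ; ↥_; ↧ₙ_; 0ℚ; toℚᵘ)
import Data.Rational.Properties as ℚP
open import Data.Rational.Unnormalised using (mkℚᵘ; *≡*; *<*)
import Data.Rational.Unnormalised as ℚᵘ
import Data.Rational.Unnormalised.Properties as ℚᵘP
open import Data.Fin using (Fin)
open import Data.Fin.Properties using (all?)
open import Data.Vec using (lookup; tabulate; map; zipWith; replicate)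
open import Data.Vec.Properties
  using (lookup-zipWith; lookup-map; lookup∘tabulate; zipWith-assoc; zipWith-comm; zipWith-inverseʳ; zipWith-identityʳ)
open import Data.List using ([]; _∷_)
open import Data.List.Relation.Unary.All using (_∷_)
open import Data.Product using (_,_; proj₁; proj₂)
open import Data.Sum using (inj₁; inj₂)
open import Data.Empty using (⊥; ⊥-elim)
open import Relation.Nullary using (¬_; Dec; yes; no; contradiction)
open import Relation.Nullary.Decidable using (map′; _×-dec_)
open import Function.Bundles using (mk⇔)
open import Relation.Binary.PropositionalEquality

/≡/⇒*≡* : ∀ z w m j → z ℚ./ suc m ≡ w ℚ./ suc j → z ℤ.* + suc j ≡ w ℤ.* + suc m
/≡/⇒*≡* z w m j eq with ℚP.fromℚᵘ-injective {mkℚᵘ z m} {mkℚᵘ w j} eq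
... | *≡* cross = cross

*≡*⇒/≡/ : ∀ z w m j → z ℤ.* + suc j ≡ w ℤ.* + suc m → z ℚ./ suc m ≡ w ℚ./ suc j
*≡*⇒/≡/ z w m j cross = ℚP.fromℚᵘ-cong {mkℚᵘ z m} {mkℚᵘ w j} (*≡* cross)

/-injective : ∀ {z w m} → z ℚ./ suc m ≡ w ℚ./ suc m → z ≡ w
/-injective {z} {w} {m} eq = ℤP.*-cancelʳ-≡ z w (+ suc m) (/≡/⇒*≡* z w m m eq)

*/*≡/ : ∀ w p r {m} → p * suc r ≡ suc m → (w ℤ.* + p) ℚ./ suc m ≡ w ℚ./ suc r
*/*≡/ w p r {m} pr≡m = *≡*⇒/≡/ (w ℤ.* + p) w m r (begin
  w ℤ.* + p ℤ.* + suc r    ≡⟨ ℤP.*-assoc w (+ p) (+ suc r) ⟩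
  w ℤ.* (+ p ℤ.* + suc r)  ≡⟨ cong (w ℤ.*_) (ℤP.pos-* p (suc r)) ⟨
  w ℤ.* + (p * suc r)      ≡⟨ cong (λ t → w ℤ.* + t) pr≡m ⟩
  w ℤ.* + suc m            ∎)
  where open ≡-Reasoning

/+/ : ∀ z w m j → z ℚ./ suc m ℚ.+ w ℚ./ suc j ≡ (z ℤ.* + suc j ℤ.+ w ℤ.* + suc m) ℚ./ (suc m * suc j)
/+/ z w m j = ℚP.toℚᵘ-injective (begin
  toℚᵘ (z ℚ./ suc m ℚ.+ w ℚ./ suc j)            ≈⟨ ℚP.toℚᵘ-homo-+ (z ℚ./ suc m) (w ℚ./ suc j) ⟩
  toℚᵘ (z ℚ./ suc m) ℚᵘ.+ toℚᵘ (w ℚ./ suc j)    ≈⟨ ℚᵘP.+-cong (ℚP.toℚᵘ-fromℚᵘ (mkℚᵘ z m)) (ℚP.toℚᵘ-fromℚᵘ (mkℚᵘ w j)) ⟩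
  mkℚᵘ (z ℤ.* + suc j ℤ.+ w ℤ.* + suc m) _      ≈⟨ ℚP.toℚᵘ-fromℚᵘ _ ⟨
  toℚᵘ ((z ℤ.* + suc j ℤ.+ w ℤ.* + suc m) ℚ./ (suc m * suc j)) ∎)
  where open ℚᵘP.≃-Reasoning

-/ : ∀ z m → ℚ.- (z ℚ./ suc m) ≡ (ℤ.- z) ℚ./ suc m
-/ z m = ℚP.toℚᵘ-injective (begin
  toℚᵘ (ℚ.- (z ℚ./ suc m))     ≈⟨ ℚP.toℚᵘ-homo‿- (z ℚ./ suc m) ⟩
  ℚᵘ.- toℚᵘ (z ℚ./ suc m)      ≈⟨ ℚᵘP.-‿cong (ℚP.toℚᵘ-fromℚᵘ (mkℚᵘ z m)) ⟩
  mkℚᵘ (ℤ.- z) m               ≈⟨ ℚP.toℚᵘ-fromℚᵘ _ ⟨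
  toℚᵘ ((ℤ.- z) ℚ./ suc m)     ∎)
  where open ℚᵘP.≃-Reasoning

∣/∣ : ∀ z m → ℚ.∣ z ℚ./ suc m ∣ ≡ + ℤ.∣ z ∣ ℚ./ suc m
∣/∣ z m = ℚP.toℚᵘ-injective (begin
  toℚᵘ ℚ.∣ z ℚ./ suc m ∣       ≈⟨ ℚP.toℚᵘ-homo-∣-∣ (z ℚ./ suc m) ⟩
  ℚᵘ.∣ toℚᵘ (z ℚ./ suc m) ∣    ≈⟨ ℚᵘP.∣-∣-cong (ℚP.toℚᵘ-fromℚᵘ (mkℚᵘ z m)) ⟩
  mkℚᵘ (+ ℤ.∣ z ∣) m           ≈⟨ ℚP.toℚᵘ-fromℚᵘ _ ⟨
  toℚᵘ (+ ℤ.∣ z ∣ ℚ./ suc m)   ∎)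
  where open ℚᵘP.≃-Reasoning

*<*⇒/< : ∀ {z m ε} → z ℤ.* ℚ.↧ ε ℤ.< ↥ ε ℤ.* + suc m → z ℚ./ suc m ℚ.< ε
*<*⇒/< {z} {m} {mkℚ _ _ _} cross =
  ℚP.toℚᵘ-cancel-< (ℚᵘP.<-respˡ-≃ (ℚᵘP.≃-sym (ℚP.toℚᵘ-fromℚᵘ (mkℚᵘ z m))) (*<* cross))

infix 4 _∈[1/_]ℤ

_∈[1/_]ℤ : ℚ → ℕ → Set
x ∈[1/ zero  ]ℤ = ⊥
x ∈[1/ suc m ]ℤ = ∃ λ z → x ≡ z ℚ./ suc m

∈[1/]ℤ-∣ : ∀ {x j m} → j ∣ suc m → x ∈[1/ j ]ℤ → x ∈[1/ suc m ]ℤ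
∈[1/]ℤ-∣ {j = suc j} (divides q m≡qj) (z , refl) = z ℤ.* + q , sym (*/*≡/ z q j (sym m≡qj))

+-∈[1/]ℤ : ∀ {x y k} → x ∈[1/ k ]ℤ → y ∈[1/ k ]ℤ → x ℚ.+ y ∈[1/ k ]ℤ
+-∈[1/]ℤ {k = suc m} (z , refl) (w , refl) = z ℤ.+ w , (begin
  z ℚ./ k ℚ.+ w ℚ./ k                             ≡⟨ /+/ z w m m ⟩
  (z ℤ.* + k ℤ.+ w ℤ.* + k) ℚ./ (k * k)           ≡⟨ cong (λ t → t ℚ./ (k * k)) (ℤP.*-distribʳ-+ (+ k) z w) ⟨
  ((z ℤ.+ w) ℤ.* + k) ℚ./ (k * k)                 ≡⟨ */*≡/ (z ℤ.+ w) k m refl ⟩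
  (z ℤ.+ w) ℚ./ k                                 ∎)
  where
  k = suc m
  open ≡-Reasoning

-‿∈[1/]ℤ : ∀ {x k} → x ∈[1/ k ]ℤ → ℚ.- x ∈[1/ k ]ℤ
-‿∈[1/]ℤ {k = suc m} (z , refl) = ℤ.- z , -/ z m

∈[1/]ℤ⇒↧∣ : ∀ {x m} → x ∈[1/ suc m ]ℤ → ↧ₙ x ∣ suc m
∈[1/]ℤ⇒↧∣ {x@(mkℚ _ _ coprime)} {m} (z , x≡z/m) =
  coprime-divisor (Coprime.sym (Coprime.recompute coprime)) (divides ℤ.∣ z ∣ (begin
    ℤ.∣ ↥ x ∣ * suc m           ≡⟨ ℤP.abs-* (↥ x) (+ suc m) ⟨
    ℤ.∣ ↥ x ℤ.* + suc m ∣       ≡⟨ cong ℤ.∣_∣ (/≡/⇒*≡* (↥ x) z _ m (trans (ℚP.↥p/↧p≡p x) x≡z/m)) ⟩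
    ℤ.∣ z ℤ.* ℚ.↧ x ∣           ≡⟨ ℤP.abs-* z (ℚ.↧ x) ⟩
    ℤ.∣ z ∣ * ↧ₙ x              ∎))
  where open ≡-Reasoning

↧∣⇒∈[1/]ℤ : ∀ {x m} → ↧ₙ x ∣ suc m → x ∈[1/ suc m ]ℤ
↧∣⇒∈[1/]ℤ {x} (divides t m≡tq) =
  ↥ x ℤ.* + t , trans (sym (ℚP.↥p/↧p≡p x)) (sym (*/*≡/ (↥ x) t _ (sym m≡tq)))

∈[1/]ℤ? : ∀ x k → Dec (x ∈[1/ k ]ℤ)
∈[1/]ℤ? x zero    = no λ ()
∈[1/]ℤ? x (suc m) = map′ ↧∣⇒∈[1/]ℤ ∈[1/]ℤ⇒↧∣ (↧ₙ x ∣? suc m)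

infix 4 _∈[1/_]ℤⁿ

_∈[1/_]ℤⁿ : ∀ {n} → ℚ^ n → ℕ → Set
u ∈[1/ k ]ℤⁿ = ∀ i → lookup u i ∈[1/ k ]ℤ

∈[1/]ℤⁿ? : ∀ {n} (u : ℚ^ n) k → Dec (u ∈[1/ k ]ℤⁿ)
∈[1/]ℤⁿ? u k = all? λ i → ∈[1/]ℤ? (lookup u i) k

∈[1/]ℤⁿ-∣ : ∀ {n j m} {u : ℚ^ n} → j ∣ suc m → u ∈[1/ j ]ℤⁿ → u ∈[1/ suc m ]ℤⁿ
∈[1/]ℤⁿ-∣ j∣m u∈ i = ∈[1/]ℤ-∣ j∣m (u∈ i)

translate-∈[1/]ℤⁿ : ∀ {n k} {u v : ℚ^ n} → v ∈[1/ k ]ℤⁿ → u ∈[1/ k ]ℤⁿ → translate v u ∈[1/ k ]ℤⁿ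
translate-∈[1/]ℤⁿ {k = k} {u} {v} v∈ u∈ i =
  subst (_∈[1/ k ]ℤ) (sym (lookup-zipWith ℚ._+_ i u v)) (+-∈[1/]ℤ (u∈ i) (v∈ i))

-‿∈[1/]ℤⁿ : ∀ {n k} {v : ℚ^ n} → v ∈[1/ k ]ℤⁿ → map ℚ.-_ v ∈[1/ k ]ℤⁿ
-‿∈[1/]ℤⁿ {k = k} {v} v∈ i = subst (_∈[1/ k ]ℤ) (sym (lookup-map i ℚ.-_ v)) (-‿∈[1/]ℤ (v∈ i))

translate-comm : ∀ {n} (u v : ℚ^ n) → translate v u ≡ translate u v
translate-comm u v = zipWith-comm ℚP.+-comm u v

translate-inverse : ∀ {n} (v u : ℚ^ n) → translate (map ℚ.-_ v) (translate v u) ≡ u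
translate-inverse {n} v u = begin
  zipWith ℚ._+_ (zipWith ℚ._+_ u v) (map ℚ.-_ v)  ≡⟨ zipWith-assoc ℚP.+-assoc u v (map ℚ.-_ v) ⟩
  zipWith ℚ._+_ u (zipWith ℚ._+_ v (map ℚ.-_ v))  ≡⟨ cong (zipWith ℚ._+_ u) (zipWith-inverseʳ ℚP.+-inverseʳ v) ⟩
  zipWith ℚ._+_ u (replicate n 0ℚ)                ≡⟨ zipWith-identityʳ ℚP.+-identityʳ u ⟩
  u                                               ∎
  where open ≡-Reasoning

translate-injective : ∀ {n} (v : ℚ^ n) {u u′} → translate v u ≡ translate v u′ → u ≡ u′
translate-injective v {u} {u′} eq =
  trans (sym (translate-inverse v u)) (trans (cong (translate (map ℚ.-_ v)) eq) (translate-inverse v u′))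

∈[1/]ℤⁿ-cancelʳ : ∀ {n k} {u v : ℚ^ n} → translate v u ∈[1/ k ]ℤⁿ → v ∈[1/ k ]ℤⁿ → u ∈[1/ k ]ℤⁿ
∈[1/]ℤⁿ-cancelʳ {k = k} {u} {v} vu∈ v∈ =
  subst (_∈[1/ k ]ℤⁿ) (translate-inverse v u)
    (translate-∈[1/]ℤⁿ {u = translate v u} {map ℚ.-_ v} (-‿∈[1/]ℤⁿ {v = v} v∈) vu∈)

∃-prime-divisor : ∀ n .{{_ : NonTrivial n}} → ∃ λ p → Prime p × p ∣ n
∃-prime-divisor n with factorise n {{ℕ.nonTrivial⇒nonZero n}}
... | record { factors = [] ; isFactorisation = n≡1 } = contradiction n≡1 ℕ.nonTrivial⇒≢1
... | record { factors = p ∷ ps ; isFactorisation = n≡p*ps ; factorsPrime = prime-p ∷ _ } =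
  p , prime-p , subst (p ∣_) (sym n≡p*ps) (m∣m*n _)

-- The gcd condition in HasDen, stated as: no prime can be cancelled from the denominator.
Reduced : ∀ {n} → ℚ^ n → ℕ → Set
Reduced u k = ∀ p r → Prime p → p * suc r ≡ k → ¬ (u ∈[1/ suc r ]ℤⁿ)

hasDen⇒∈[1/]ℤⁿ : ∀ {n k} {u : ℚ^ n} → HasDen u k → u ∈[1/ k ]ℤⁿ
hasDen⇒∈[1/]ℤⁿ {k = suc m} (a , u≡a/k , _) i = a i , u≡a/k i

hasDen⇒reduced : ∀ {n k} {u : ℚ^ n} → HasDen u k → Reduced u k
hasDen⇒reduced {k = suc m} {u} (a , u≡a/k , gcd≡1) p r prime-p pr≡k u∈ =
  ¬prime[1] (subst Prime (gcd≡1 p p∣k p∣a) prime-p)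
  where
  p∣k : p ∣ suc m
  p∣k = divides (suc r) (trans (sym pr≡k) (ℕP.*-comm p (suc r)))
  p∣a : ∀ i → p ∣ ℤ.∣ a i ∣
  p∣a i with u∈ i
  ... | b , u≡b/r = divides ℤ.∣ b ∣ (trans (cong ℤ.∣_∣ a≡bp) (ℤP.abs-* b (+ p)))
    where
    a≡bp : a i ≡ b ℤ.* + p
    a≡bp = /-injective (trans (sym (u≡a/k i)) (trans u≡b/r (sym (*/*≡/ b p r pr≡k))))

∈[1/]ℤⁿ∧reduced⇒hasDen : ∀ {n m} {u : ℚ^ n} → u ∈[1/ suc m ]ℤⁿ → Reduced u (suc m) → HasDen u (suc m)
∈[1/]ℤⁿ∧reduced⇒hasDen {m = m} {u} u∈ reduced = a , (λ i → proj₂ (u∈ i)) , gcd≡1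
  where
  a : Fin _ → ℤ
  a i = proj₁ (u∈ i)
  gcd≡1 : ∀ c → c ∣ suc m → (∀ i → c ∣ ℤ.∣ a i ∣) → c ≡ 1
  gcd≡1 0 0∣k _ = contradiction (0∣⇒≡0 0∣k) ℕP.1+n≢0
  gcd≡1 1 _ _ = refl
  gcd≡1 c@(2+ _) c∣k c∣a with ∃-prime-divisor c
  ... | p , prime-p , p∣c with ∣-trans p∣c c∣k
  ...   | divides 0 k≡0 = contradiction k≡0 ℕP.1+n≢0
  ...   | divides (suc r) k≡rp = ⊥-elim (reduced p r prime-p pr≡k u∈r)
    where
    pr≡k : p * suc r ≡ suc m
    pr≡k = trans (ℕP.*-comm p (suc r)) (sym k≡rp)
    u∈r : u ∈[1/ suc r ]ℤⁿ
    u∈r i with ℤ∣.∣ᵤ⇒∣ {+ p} {a i} (∣-trans p∣c (c∣a i))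
    ... | ℤ∣.divides b a≡bp =
      b , trans (proj₂ (u∈ i)) (trans (cong (λ t → t ℚ./ suc m) a≡bp) (*/*≡/ b p r pr≡k))

hasDen∧∈[1/]ℤⁿ∧coprime⇒≡1 : ∀ {n k j} {u : ℚ^ n} → HasDen u k → u ∈[1/ j ]ℤⁿ → Coprime k j → k ≡ 1
hasDen∧∈[1/]ℤⁿ∧coprime⇒≡1 {k = suc m} {zero} _ _ coprime = coprime (∣-refl , suc m ∣0)
hasDen∧∈[1/]ℤⁿ∧coprime⇒≡1 {k = suc m} {suc j} (a , u≡a/k , gcd≡1) u∈ coprime = gcd≡1 (suc m) ∣-refl k∣a
  where
  k∣a : ∀ i → suc m ∣ ℤ.∣ a i ∣
  k∣a i with u∈ i
  ... | b , u≡b/j = coprime-divisor coprime (divides ℤ.∣ b ∣ (begin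
    suc j * ℤ.∣ a i ∣           ≡⟨ ℕP.*-comm (suc j) ℤ.∣ a i ∣ ⟩
    ℤ.∣ a i ∣ * suc j           ≡⟨ ℤP.abs-* (a i) (+ suc j) ⟨
    ℤ.∣ a i ℤ.* + suc j ∣       ≡⟨ cong ℤ.∣_∣ (/≡/⇒*≡* (a i) b m j (trans (sym (u≡a/k i)) u≡b/j)) ⟩
    ℤ.∣ b ℤ.* + suc m ∣         ≡⟨ ℤP.abs-* b (+ suc m) ⟩
    ℤ.∣ b ∣ * suc m             ∎))
    where open ≡-Reasoning

∃-hasDen-∣ : ∀ {n} (u : ℚ^ n) m → u ∈[1/ suc m ]ℤⁿ → ∃ λ j → HasDen u j × j ∣ suc m
∃-hasDen-∣ u m = search m (<-wellFounded m)
  where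
  search : ∀ m → Acc _<_ m → u ∈[1/ suc m ]ℤⁿ → ∃ λ j → HasDen u j × j ∣ suc m
  search m (acc smaller) u∈ with anyUpTo? (λ j → (suc j ∣? suc m) ×-dec ∈[1/]ℤⁿ? u (suc j)) m
  ... | yes (j , j<m , j∣m , u∈j) =
    let i , hasDen-i , i∣j = search j (smaller j<m) u∈j in i , hasDen-i , ∣-trans i∣j j∣m
  ... | no no-smaller = suc m , ∈[1/]ℤⁿ∧reduced⇒hasDen {u = u} u∈ reduced , ∣-refl
    where
    reduced : Reduced u (suc m)
    reduced p r prime-p pr≡k u∈r = no-smaller (r , r<m , divides p (sym pr≡k) , u∈r)
      where
      r<m : r < m
      r<m = ℕP.≤-pred (subst (suc r <_) (trans (ℕP.*-comm (suc r) p) pr≡k)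
              (ℕP.m<m*n (suc r) p (ℕ.nonTrivial⇒n>1 p {{prime⇒nonTrivial prime-p}})))

∣⇒∣radUpTo : ∀ {p d} q → Prime p → p ∣ d → p ≤ q → p ∣ radUpTo d q
∣⇒∣radUpTo zero    prime-0 _ z≤n = contradiction prime-0 ¬prime[0]
∣⇒∣radUpTo {p} {d} (suc q) prime-p p∣d p≤q
  with prime? (suc q) ×-dec (suc q ∣? d) | p ℕP.≟ suc q
... | yes _     | yes refl = m∣m*n (radUpTo d q)
... | yes _     | no p≢q   = ∣n⇒∣m*n (suc q) (∣⇒∣radUpTo q prime-p p∣d (ℕP.≤-pred (ℕP.≤∧≢⇒< p≤q p≢q)))
... | no ¬q∣d   | yes refl = contradiction (prime-p , p∣d) ¬q∣d
... | no _      | no p≢q   = ∣⇒∣radUpTo q prime-p p∣d (ℕP.≤-pred (ℕP.≤∧≢⇒< p≤q p≢q))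

∣⇒∣rad : ∀ {p d} .{{_ : NonZero d}} → Prime p → p ∣ d → p ∣ rad d
∣⇒∣rad {d = d} prime-p p∣d = ∣⇒∣radUpTo d prime-p p∣d (∣⇒≤ p∣d)

*rad∣*⇒∣ : ∀ {d p r} .{{_ : NonZero d}} → Prime p → d * rad d ∣ p * r → d ∣ r
*rad∣*⇒∣ {d} {p} {r} prime-p drad∣pr with p ∣? d
... | yes p∣d = *-cancelˡ-∣ p {{prime⇒nonZero prime-p}} (∣-trans pd∣drad drad∣pr)
  where
  pd∣drad : p * d ∣ d * rad d
  pd∣drad = subst (_∣ d * rad d) (ℕP.*-comm d p) (*-monoʳ-∣ d (∣⇒∣rad prime-p p∣d))
... | no p∤d = coprime-divisor d-coprime-p (∣-trans (m∣m*n (rad d)) drad∣pr)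
  where
  d-coprime-p : Coprime d p
  d-coprime-p (e∣d , e∣p) with prime⇒irreducible prime-p e∣p
  ... | inj₁ e≡1 = e≡1
  ... | inj₂ refl = contradiction e∣d p∤d

hasDen-translate : ∀ {n d k} {u v : ℚ^ n} .{{_ : NonZero d}} →
                   v ∈[1/ d ]ℤⁿ → d * rad d ∣ k → HasDen u k → HasDen (translate v u) k
hasDen-translate {d = d} {zero} _ _ ()
hasDen-translate {d = d} {suc m} {u} {v} v∈ drad∣k hasDen-u =
  ∈[1/]ℤⁿ∧reduced⇒hasDen {u = translate v u}
    (translate-∈[1/]ℤⁿ {u = u} {v} (∈[1/]ℤⁿ-∣ {u = v} d∣k v∈) u∈) reduced
  where
  d∣k : d ∣ suc m
  d∣k = ∣-trans (m∣m*n (rad d)) drad∣k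
  u∈ : u ∈[1/ suc m ]ℤⁿ
  u∈ = hasDen⇒∈[1/]ℤⁿ {u = u} hasDen-u
  reduced : Reduced (translate v u) (suc m)
  reduced p r prime-p pr≡k vu∈r =
    hasDen⇒reduced {u = u} hasDen-u p r prime-p pr≡k
      (∈[1/]ℤⁿ-cancelʳ {u = u} {v} vu∈r (∈[1/]ℤⁿ-∣ {u = v} d∣r v∈))
    where
    d∣r : d ∣ suc r
    d∣r = *rad∣*⇒∣ prime-p (subst (d * rad d ∣_) (sym pr≡k) drad∣k)

translate-preservesDen : ∀ {n d k} {v : ℚ^ n} {U : ℚ^ n → Set} →
                         HasDen v d → d * rad d ∣ k → PreservesDen U (translate v) k
translate-preservesDen {d = suc _} {k} {v} hasDen-v drad∣k =
    (λ u _ → hasDen-translate {u = u} v∈ drad∣k)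
  , (λ _ _ _ _ _ _ → translate-injective v)
  , λ { _ (u , Uu , refl) hasDen-vu →
        u , Uu , subst (λ u → HasDen u k) (translate-inverse v u)
                   (hasDen-translate {u = translate v u} (-‿∈[1/]ℤⁿ {v = v} v∈) drad∣k hasDen-vu) , refl }
  where
  v∈ = hasDen⇒∈[1/]ℤⁿ {u = v} hasDen-v

integral⇒preservesAllDen : ∀ {n d} {v : ℚ^ n} {U : ℚ^ n → Set} →
                           HasDen v d → IsIntegral v → PreservesAllDen U (translate v)
integral⇒preservesAllDen {v = v} hasDen-v v∈ℤⁿ k _
  with hasDen∧∈[1/]ℤⁿ∧coprime⇒≡1 {u = v} hasDen-v v∈ℤⁿ (Coprime.sym (Coprime.1-coprimeTo _))
... | refl = translate-preservesDen hasDen-v (1∣ k)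

scaledFloor : ℚ → ℕ → ℤ
scaledFloor x M = (↥ x ℤ.* + M) ℤ./ℕ ↧ₙ x

scaledFloor-error : ∀ x m →
  ℚ.∣ scaledFloor x (suc m) ℚ./ suc m ℚ.- x ∣ ≡ + ((↥ x ℤ.* + suc m) ℤ.%ℕ ↧ₙ x) ℚ./ (suc m * ↧ₙ x)
scaledFloor-error x m = begin
  ℚ.∣ z ℚ./ M ℚ.- x ∣                                  ≡⟨ cong (λ y → ℚ.∣ z ℚ./ M ℚ.- y ∣) (ℚP.↥p/↧p≡p x) ⟨
  ℚ.∣ z ℚ./ M ℚ.+ ℚ.- (p ℚ./ q) ∣                      ≡⟨ cong (λ y → ℚ.∣ z ℚ./ M ℚ.+ y ∣) (-/ p _) ⟩
  ℚ.∣ z ℚ./ M ℚ.+ (ℤ.- p) ℚ./ q ∣                      ≡⟨ cong ℚ.∣_∣ (/+/ z (ℤ.- p) m _) ⟩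
  ℚ.∣ (z ℤ.* + q ℤ.+ (ℤ.- p) ℤ.* + M) ℚ./ (M * q) ∣    ≡⟨ cong (λ t → ℚ.∣ t ℚ./ (M * q) ∣) numerator ⟩
  ℚ.∣ (ℤ.- + r) ℚ./ (M * q) ∣                          ≡⟨ ∣/∣ (ℤ.- + r) _ ⟩
  + ℤ.∣ ℤ.- + r ∣ ℚ./ (M * q)                          ≡⟨ cong (λ t → + t ℚ./ (M * q)) (ℤP.∣-i∣≡∣i∣ (+ r)) ⟩
  + r ℚ./ (M * q)                                      ∎
  where
  open ≡-Reasoning
  M = suc m
  p = ↥ x
  q = ↧ₙ x
  z = scaledFloor x M
  r = (p ℤ.* + M) ℤ.%ℕ q
  cancel : ∀ a b → a ℤ.- (b ℤ.+ a) ≡ ℤ.- b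
  cancel = solve-∀
  numerator : z ℤ.* + q ℤ.+ (ℤ.- p) ℤ.* + M ≡ ℤ.- + r
  numerator = begin
    z ℤ.* + q ℤ.+ (ℤ.- p) ℤ.* + M      ≡⟨ cong (λ t → z ℤ.* + q ℤ.+ t) (ℤP.neg-distribˡ-* p (+ M)) ⟨
    z ℤ.* + q ℤ.- p ℤ.* + M            ≡⟨ cong (λ t → z ℤ.* + q ℤ.- t) (ℤ.a≡a%ℕn+[a/ℕn]*n (p ℤ.* + M) q) ⟩
    z ℤ.* + q ℤ.- (+ r ℤ.+ z ℤ.* + q)  ≡⟨ cancel (z ℤ.* + q) (+ r) ⟩
    ℤ.- + r                            ∎

scaledFloor-approx : ∀ x ε m → 0ℚ ℚ.< ε → ↧ₙ ε ≤ suc m →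
                     ℚ.∣ scaledFloor x (suc m) ℚ./ suc m ℚ.- x ∣ ℚ.< ε
scaledFloor-approx x (mkℚ (+ 0) _ _)        m (ℚ.*<* (ℤ.+<+ ())) _
scaledFloor-approx x (mkℚ ℤ.-[1+ _ ] _ _)   m (ℚ.*<* ()) _
scaledFloor-approx x ε@(mkℚ (+ suc a) b _) m _ b≤M =
  subst (ℚ._< ε) (sym (scaledFloor-error x m))
    (*<*⇒/< {+ r} (subst₂ ℤ._<_ (ℤP.pos-* r (suc b)) (ℤP.pos-* (suc a) (M * q)) (ℤ.+<+ bound)))
  where
  M = suc m
  q = ↧ₙ x
  r = (↥ x ℤ.* + M) ℤ.%ℕ q
  open ℕP.≤-Reasoning
  bound : r * suc b < suc a * (M * q)
  bound = begin-strict
    r * suc b        ≤⟨ ℕP.*-monoʳ-≤ r b≤M ⟩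
    r * M            <⟨ ℕP.*-monoˡ-< M (ℤ.n%ℕd<d (↥ x ℤ.* + M) q) ⟩
    q * M            ≡⟨ ℕP.*-comm q M ⟩
    M * q            ≤⟨ ℕP.m≤n*m (M * q) (suc a) ⟩
    suc a * (M * q)  ∎

open⇒∃-fine-grid-points : ∀ {n} {U : ℚ^ n → Set} {u} → IsOpen U → U u →
  ∃ λ N → ∀ m → N ≤ suc m → ∃ λ w → U w × w ∈[1/ suc m ]ℤⁿ
open⇒∃-fine-grid-points {u = u} U-open Uu with U-open u Uu
... | ε , 0<ε , ball = ↧ₙ ε , λ m N≤M →
  grid m , ball (grid m) (near m N≤M) , λ i → scaledFloor (lookup u i) (suc m) , lookup∘tabulate _ i
  where
  grid : ∀ m → ℚ^ _
  grid m = tabulate λ i → scaledFloor (lookup u i) (suc m) ℚ./ suc m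
  near : ∀ m → ↧ₙ ε ≤ suc m → ∀ i → ℚ.∣ lookup (grid m) i ℚ.- lookup u i ∣ ℚ.< ε
  near m N≤M i rewrite lookup∘tabulate (λ i → scaledFloor (lookup u i) (suc m) ℚ./ suc m) i =
    scaledFloor-approx (lookup u i) ε m 0<ε N≤M

∣1+*⇒coprime : ∀ {d j N} → j ∣ suc (d * N) → Coprime d j
∣1+*⇒coprime {d} {j} {N} j∣1+dN {e} (e∣d , e∣j) =
  ∣1⇒≡1 (∣m+n∣m⇒∣n (subst (e ∣_) (ℕP.+-comm 1 (d * N)) (∣-trans e∣j j∣1+dN)) (∣m⇒∣m*n N e∣d))

preservesAllDen⇒integral : ∀ {n d} {v : ℚ^ n} {U : ℚ^ n → Set} →
  HasDen v d → IsOpen U → (∃ λ u → U u) → PreservesAllDen U (translate v) → IsIntegral v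
preservesAllDen⇒integral {d = suc d′} {v} hasDen-v U-open (u , Uu) preserves
  with open⇒∃-fine-grid-points U-open Uu
... | N , grid-point with grid-point (suc d′ * N) (ℕP.m≤n⇒m≤1+n (ℕP.m≤n*m N (suc d′)))
... | w , Uw , w∈ with ∃-hasDen-∣ w (suc d′ * N) w∈
... | suc j , hasDen-w , j∣1+dN = subst (λ k → v ∈[1/ k ]ℤⁿ) d≡1 (hasDen⇒∈[1/]ℤⁿ {u = v} hasDen-v)
  where
  hasDen-vw : HasDen (translate v w) (suc j)
  hasDen-vw = proj₁ (preserves (suc j) (s≤s z≤n)) w Uw hasDen-w
  v∈ : v ∈[1/ suc j ]ℤⁿ
  v∈ = ∈[1/]ℤⁿ-cancelʳ {u = v} {w}
         (subst (λ y → y ∈[1/ suc j ]ℤⁿ) (translate-comm w v) (hasDen⇒∈[1/]ℤⁿ {u = translate v w} hasDen-vw))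
         (hasDen⇒∈[1/]ℤⁿ {u = w} hasDen-w)
  d≡1 : suc d′ ≡ 1
  d≡1 = hasDen∧∈[1/]ℤⁿ∧coprime⇒≡1 {u = v} hasDen-v v∈ (∣1+*⇒coprime j∣1+dN)

lemma5p1 : ∀ (n : ℕ) (v : ℚ^ n) (d : ℕ) → HasDen v d →
    (U : ℚ^ n → Set) → IsOpen U → (∃ λ u → U u) →
    (∀ (k : ℕ) → d * rad d ∣ k → PreservesDen U (translate v) k) ×
    (PreservesAllDen U (translate v) ⇔ IsIntegral v)
lemma5p1 _ _ _ hasDen-v _ U-open nonempty =
    (λ k → translate-preservesDen hasDen-v)
  , mk⇔ (preservesAllDen⇒integral hasDen-v U-open nonempty) (integral⇒preservesAllDen hasDen-v)
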